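{- Let $(E,\mathcal{S})$ be a $\tau$-SNC set system with positive costs $w$, $\bigcup_{S\in\mathcal{S}}S=E$, and layer decomposition $Z_1,\dots,Z_L$, and run the forward phase described in the context. Fix an epoch $k$. For an iteration $j$ of epoch $k$ let $p_j^{\min}=\min_S p_j(S)$, the minimum over all sets participating in iteration $j$. Then for every iteration $j$ of epoch $k$ such that iteration $j+1$ of epoch $k$ also occurs, $p_{j+1}^{\min}\ge\frac32\,p_j^{\min}$.
   Context: Definitions: for $X\subseteq E$ and $e\in X$, with $\mathcal{Q}$ the sets containing $e$, $e$ is a $\tau$-SNC element within $X$ if for every $\mathcal{P}\subseteq\mathcal{Q}$ there are $S_1,\dots,S_r\in\mathcal{P}$, $r\le\tau$, with $\bigcup_{S\in\mathcal{P}}(S\cap X)=\bigcup_{i=1}^r(S_i\cap X)$; the system is $\tau$-SNC if every nonempty $X\subseteq E$ contains such an element. Layer decomposition: $Z_1$ is the set of $\tau$-SNC elements within $E$, $Z_k$ the set of $\tau$-SNC elements within $E\setminus(Z_1\cup\dots\cup Z_{k-1})$, until no elements remain. Forward phase: initialize $\mathcal{A}=\emptyset$ and $\alpha(e)=0$ for all $e$. For epochs $k=1,\dots,L$: let $R_k$ be the elements of $Z_k$ not covered by $\mathcal{A}$ at the start of epoch $k$; run iterations $j=1,2,\dots$ as long as some element of $R_k$ is uncovered by $\mathcal{A}$. In iteration $j$, the participating sets are those $S\notin\mathcal{A}$ and the participating elements are those $e\in R_k$ not covered by $\mathcal{A}$. For each participating set $S$ let $d_j(S)$ be the number of participating elements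 in $S$, $c_j(S)=w(S)-\sum_{e\in S}\alpha(e)$ and $p_j(S)=c_j(S)/d_j(S)$ (taken as $+\infty$ if $d_j(S)=0$). For each participating element $e$, let $q_j(e)=\min_{S\ni e}p_j(S)$ and increase $\alpha(e)$ by $q_j(e)$ (all simultaneously). Then every participating set $S$ with $\sum_{e\in S}\alpha(e)\ge w(S)/8$ is added to $\mathcal{A}$.
   Formalization: The positive costs $w$ take rational values. -}

module Defs where

open import Data.Nat using (ℕ; zero; suc; _≤_)
open import Data.Bool using (Bool; true; false; not; _∧_; if_then_else_)
open import Data.Fin using (Fin)
open import Data.Fin.Subset using (Subset; _∈_; Nonempty; Empty; _─_; _∩_; ⊥; ⊤)
open import Data.Vec using (lookup; tabulate)
open import Data.List using (List; []; _∷_; length; map; foldr; filterᵇ; allFin)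
open import Data.Bool.ListAction using (any)
open import Data.List.Relation.Unary.All using (All)
import Data.List.Membership.Propositional as LM
open import Data.Product using (Σ; ∃; _×_; _,_)
open import Data.Integer using (+_)
open import Data.Rational using (ℚ; 0ℚ; _+_; _-_; _*_; _/_; _≤_; _≤ᵇ_; _⊓_)
open import Data.Unit using () renaming (⊤ to Unit)
open import Data.Empty using () renaming (⊥ to Void)
open import Function.Bundles using (_⇔_)
open import Relation.Nullary using (¬_)
open import Relation.Binary.PropositionalEquality using (_≡_)

-- Extended rationals ℚ ∪ {+∞} (for p_j(S) = +∞ when d_j(S) = 0)

data ℚ∞ : Set where
  fin : ℚ → ℚ∞
  ∞   : ℚ∞

min∞ : ℚ∞ → ℚ∞ → ℚ∞
min∞ (fin x) (fin y) = fin (x ⊓ y)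
min∞ (fin x) ∞       = fin x
min∞ ∞       y       = y

minimum∞ : List ℚ∞ → ℚ∞
minimum∞ = foldr min∞ ∞

_≤∞_ : ℚ∞ → ℚ∞ → Set
fin x ≤∞ fin y = x Data.Rational.≤ y
fin x ≤∞ ∞     = Unit
∞     ≤∞ fin y = Void
∞     ≤∞ ∞     = Unit

scale∞ : ℚ → ℚ∞ → ℚ∞
scale∞ c (fin x) = fin (c * x)
scale∞ c ∞       = ∞

sumℚ : List ℚ → ℚ
sumℚ = foldr _+_ 0ℚ

iter : ∀ {A : Set} → (A → A) → ℕ → A → A
iter f zero    x = x
iter f (suc k) x = f (iter f k x)

mem : ∀ {n} → Fin n → Subset n → Bool
mem x p = lookup p x

module System {n m : ℕ} (𝒮 : Fin m → Subset n) where

  Covers : Set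
  Covers = ∀ (e : Fin n) → ∃ λ (i : Fin m) → e ∈ 𝒮 i

  SNCElem : ℕ → Subset n → Fin n → Set
  SNCElem τ X e =
    e ∈ X ×
    (∀ (P : Subset m) → (∀ i → i ∈ P → e ∈ 𝒮 i) →
       ∃ λ (Ls : List (Fin m)) →
         length Ls Data.Nat.≤ τ × All (_∈ P) Ls ×
         (∀ (x : Fin n) →
            (x ∈ X × ∃ λ i → i ∈ P × x ∈ 𝒮 i)
            ⇔ (x ∈ X × ∃ λ i → i LM.∈ Ls × x ∈ 𝒮 i)))

  SNCSystem : ℕ → Set
  SNCSystem τ = ∀ (X : Subset n) → Nonempty X → ∃ λ e → SNCElem τ X e

  data Layers (τ : ℕ) : Subset n → List (Subset n) → Set where
    stop : ∀ {X} → Empty X → Layers τ X []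
    next : ∀ {X Z Zs} → Nonempty X →
           (∀ e → e ∈ Z ⇔ SNCElem τ X e) →
           Layers τ (X ─ Z) Zs → Layers τ X (Z ∷ Zs)

  LayerDecomposition : ℕ → List (Subset n) → Set
  LayerDecomposition τ Zs = Layers τ ⊤ Zs

  record State : Set where
    constructor ⟨_,_⟩
    field
      𝒜 : Subset m
      α : Fin n → ℚ
  open State public

  initState : State
  initState = ⟨ ⊥ , (λ _ → 0ℚ) ⟩

  module Forward (w : Fin m → ℚ) where

    covered : State → Fin n → Bool
    covered st e = any (λ i → mem i (𝒜 st) ∧ mem e (𝒮 i)) (allFin m)

    Uncovered : Subset n → State → Set
    Uncovered R st = ∃ λ e → mem e R ≡ true × covered st e ≡ false

    remaining : Subset n → State → Subset n
    remaining Z st = tabulate (λ e → mem e Z ∧ not (covered st e))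

    partElem : Subset n → State → Fin n → Bool
    partElem R st e = mem e R ∧ not (covered st e)

    partSet : State → Fin m → Bool
    partSet st i = not (mem i (𝒜 st))

    partSets : State → List (Fin m)
    partSets st = filterᵇ (partSet st) (allFin m)

    αsum : (Fin n → ℚ) → Fin m → ℚ
    αsum α′ i = sumℚ (map α′ (filterᵇ (λ e → mem e (𝒮 i)) (allFin n)))

    d : Subset n → State → Fin m → ℕ
    d R st i = length (filterᵇ (λ e → partElem R st e ∧ mem e (𝒮 i)) (allFin n))

    c : State → Fin m → ℚ
    c st i = w i - αsum (α st) i

    p : Subset n → State → Fin m → ℚ∞
    p R st i with d R st i
    ... | zero  = ∞
    ... | suc k = fin (c st i * ((+ 1) / suc k))

    q : Subset n → State → Fin n → ℚ∞
    q R st e = minimum∞ (map (p R st)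
                 (filterᵇ (λ i → mem e (𝒮 i)) (partSets st)))

    -- increment of α(e) (q is finite for participating elements; the
    -- ∞ case never arises, and is sent to 0)
    incr : ℚ∞ → ℚ
    incr (fin x) = x
    incr ∞       = 0ℚ

    step : Subset n → State → State
    step R st = ⟨ 𝒜′ , α′ ⟩
      where
        α′ : Fin n → ℚ
        α′ e = if partElem R st e then α st e + incr (q R st e) else α st e
        𝒜′ : Subset m
        𝒜′ = tabulate (λ i → mem i (𝒜 st) ∨′
                (partSet st i ∧ ((w i * ((+ 1) / 8)) ≤ᵇ αsum α′ i)))
          where
            _∨′_ : Bool → Bool → Bool
            true  ∨′ _ = true
            false ∨′ b = b

    pmin : Subset n → State → ℚ∞
    pmin R st = minimum∞ (map (p R st) (partSets st))

    data EpochRun (R : Subset n) : State → State → Set where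
      done : ∀ {st} → ¬ Uncovered R st → EpochRun R st st
      more : ∀ {st st′} → Uncovered R st →
             EpochRun R (step R st) st′ → EpochRun R st st′

    data EpochsRun : List (Subset n) → State → State → Set where
      []  : ∀ {st} → EpochsRun [] st st
      _∷_ : ∀ {Z Zs st st₁ st′} →
            EpochRun (remaining Z st) st st₁ →
            EpochsRun Zs st₁ st′ → EpochsRun (Z ∷ Zs) st st′

module Submission where

-- Write st for the state at the start of iteration j, st′ = step R st for the next one,
-- and u = p_j^min.  Take a set S that still participates in iteration j+1 and has
-- d = d_{j+1}(S) ≥ 1 participating elements (if d = 0 its price is +∞).
--   * S participated in iteration j with at least these d elements, so p_j(S) is finite
--     and hence u is finite (the minimum lies below p_j(S)).
--   * Each of the d elements participated in iteration j and gained q_j(e) ≥ u, so S has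
--     paid at least d·u in total (payments α are never negative).
--   * S was not added to 𝒜 after iteration j, so its payment A is below w(S)/8, and
--     p_{j+1}(S) = (w(S) − A)/d ≥ (3/2)·A/d ≥ (3/2)·u.
-- The non-negativity of α (and of the prices) holds in every reachable state: this is
-- the invariant `Sound`, established for the initial state and preserved by every step.

open import Defs
open import Data.Nat as ℕ using (ℕ; zero; suc)
open import Data.Nat.Coprimality as Coprime using ()
open import Data.Bool using (Bool; true; false; T; not; _∧_)
open import Data.Bool.Properties using (T-∧)
open import Data.Empty using (⊥; ⊥-elim)
open import Data.Fin using (Fin)
open import Data.Fin.Subset using (Subset)
open import Data.Vec.Properties using (lookup∘tabulate)
open import Data.List using (List; []; _∷_; _++_; length; map; filterᵇ; allFin)
open import Data.List.Membership.Propositional using () renaming (_∈_ to _∈ₗ_)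
open import Data.List.Membership.Propositional.Properties using (∈-filter⁺; ∈-filter⁻; ∈-allFin)
open import Data.List.Relation.Unary.Any as Any using (here; there)
open import Data.List.Relation.Unary.Any.Properties using (any⁺; any⁻)
open import Data.List.Relation.Binary.Sublist.Heterogeneous.Properties
  using (length-mono-≤; ⊆-filter-Sublist)
open import Data.List.Relation.Binary.Sublist.Propositional using (⊆-refl)
open import Data.Integer as ℤ using (ℤ; +_; 1ℤ)
open import Data.Integer.Tactic.RingSolver using (solve-∀)
open import Data.Rational
  using (ℚ; 0ℚ; 1ℚ; mkℚ; _+_; _-_; -_; _*_; _/_; 1/_; _≤_; _<_; nonNegative)
open import Data.Rational.Properties
open import Data.Rational.Solver using (module +-*-Solver)
open import Data.Rational.Unnormalised using (*≡*)
import Data.Rational.Unnormalised.Properties as ℚᵘ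
open import Data.Product using (_×_; _,_; proj₁; proj₂; ∃)
open import Data.Unit using (tt)
open import Function using (_∘_; Equivalence)
open import Relation.Nullary.Decidable using (T?)
open import Relation.Binary.PropositionalEquality

fromℕ : ℕ → ℚ
fromℕ n = mkℚ (+ n) 0 (Coprime.sym (Coprime.1-coprimeTo n))

fromℕ-suc : ∀ n → fromℕ (suc n) ≡ 1ℚ + fromℕ n
fromℕ-suc n = toℚᵘ-injective
  (ℚᵘ.≃-sym (ℚᵘ.≃-trans (toℚᵘ-homo-+ 1ℚ (fromℕ n)) (*≡* (cross-multiplied (+ n)))))
  where
  cross-multiplied : ∀ (x : ℤ) → (1ℤ ℤ.* 1ℤ ℤ.+ x ℤ.* 1ℤ) ℤ.* 1ℤ ≡ (1ℤ ℤ.+ x) ℤ.* (1ℤ ℤ.* 1ℤ)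
  cross-multiplied = solve-∀

fromℕ-inverse : ∀ k → fromℕ (suc k) * ((+ 1) / suc k) ≡ 1ℚ
fromℕ-inverse k = begin
  fromℕ (suc k) * ((+ 1) / suc k)   ≡⟨ cong (fromℕ (suc k) *_) (↥p/↧p≡p (1/ fromℕ (suc k))) ⟩
  fromℕ (suc k) * 1/ fromℕ (suc k)  ≡⟨ *-inverseʳ (fromℕ (suc k)) ⟩
  1ℚ                                ∎
  where open ≡-Reasoning

≤-divide : ∀ k {x y} → fromℕ (suc k) * x ≤ y → x ≤ y * ((+ 1) / suc k)
≤-divide k {x} {y} kx≤y = *-cancelˡ-≤-pos K (begin
  K * x        ≤⟨ kx≤y ⟩
  y            ≡⟨ sym (*-identityʳ y) ⟩
  y * 1ℚ       ≡⟨ cong (y *_) (sym (fromℕ-inverse k)) ⟩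
  y * (K * r)  ≡⟨ solve 3 (λ y K r → y :* (K :* r) := K :* (y :* r)) refl y K r ⟩
  K * (y * r)  ∎)
  where
  open ≤-Reasoning
  open +-*-Solver
  K = fromℕ (suc k)
  r = (+ 1) / suc k

≤-move : ∀ x a b → x + a ≤ b → x ≤ b - a
≤-move x a b x+a≤b = begin
  x            ≡⟨ solve 2 (λ x a → x := (x :+ a) :- a) refl x a ⟩
  (x + a) - a  ≤⟨ +-monoˡ-≤ (- a) x+a≤b ⟩
  b - a        ∎
  where open ≤-Reasoning; open +-*-Solver

eighth≤ : ∀ w → 0ℚ ≤ w → w * ((+ 1) / 8) ≤ w
eighth≤ w 0≤w = begin
  w * ((+ 1) / 8)  ≤⟨ *-monoˡ-≤-nonNeg w {{nonNegative 0≤w}} (≤ᵇ⇒≤ {(+ 1) / 8} {1ℚ} _) ⟩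
  w * 1ℚ           ≡⟨ *-identityʳ w ⟩
  w                ∎
  where open ≤-Reasoning

residual-nonneg : ∀ w A → 0ℚ ≤ w → A ≤ w * ((+ 1) / 8) → 0ℚ ≤ w - A
residual-nonneg w A 0≤w A≤w/8 =
  ≤-move 0ℚ A w (≤-trans (≤-reflexive (+-identityˡ A)) (≤-trans A≤w/8 (eighth≤ w 0≤w)))

underpaid-residual : ∀ w A → 0ℚ ≤ w → A ≤ w * ((+ 1) / 8) → ((+ 3) / 2) * A ≤ w - A
underpaid-residual w A 0≤w A≤w/8 = ≤-move _ A w (begin
  ((+ 3) / 2) * A + A              ≡⟨ solve 1 (λ A → con ((+ 3) / 2) :* A :+ A := con ((+ 5) / 2) :* A) refl A ⟩
  ((+ 5) / 2) * A                  ≤⟨ *-monoˡ-≤-nonNeg ((+ 5) / 2) A≤w/8 ⟩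
  ((+ 5) / 2) * (w * ((+ 1) / 8))  ≡⟨ solve 1 (λ w → con ((+ 5) / 2) :* (w :* con ((+ 1) / 8)) := con ((+ 5) / 16) :* w) refl w ⟩
  ((+ 5) / 16) * w                 ≤⟨ *-monoʳ-≤-nonNeg w {{nonNegative 0≤w}} (≤ᵇ⇒≤ {(+ 5) / 16} {1ℚ} _) ⟩
  1ℚ * w                           ≡⟨ *-identityˡ w ⟩
  w                                ∎)
  where open ≤-Reasoning; open +-*-Solver

price-growth : ∀ k u A w → 0ℚ ≤ w → fromℕ (suc k) * u ≤ A → A ≤ w * ((+ 1) / 8) →
               ((+ 3) / 2) * u ≤ (w - A) * ((+ 1) / suc k)
price-growth k u A w 0≤w ku≤A A≤w/8 = ≤-divide k (begin
  K * (((+ 3) / 2) * u)  ≡⟨ solve 2 (λ K u → K :* (con ((+ 3) / 2) :* u) := con ((+ 3) / 2) :* (K :* u)) refl K u ⟩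
  ((+ 3) / 2) * (K * u)  ≤⟨ *-monoˡ-≤-nonNeg ((+ 3) / 2) ku≤A ⟩
  ((+ 3) / 2) * A        ≤⟨ underpaid-residual w A 0≤w A≤w/8 ⟩
  w - A                  ∎)
  where
  open ≤-Reasoning
  open +-*-Solver
  K = fromℕ (suc k)

≤∞-top : ∀ x → x ≤∞ ∞
≤∞-top (fin x) = tt
≤∞-top ∞       = tt

≤∞-trans : ∀ x y z → x ≤∞ y → y ≤∞ z → x ≤∞ z
≤∞-trans (fin x) (fin y) (fin z) x≤y y≤z = ≤-trans x≤y y≤z
≤∞-trans (fin x) _       ∞       _   _   = tt
≤∞-trans ∞       ∞       ∞       _   _   = tt

≤∞-fin : ∀ x v → x ≤∞ fin v → ∃ λ u → x ≡ fin u
≤∞-fin (fin u) v _ = u , refl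

min∞-≤ˡ : ∀ x y → min∞ x y ≤∞ x
min∞-≤ˡ (fin x) (fin y) = p⊓q≤p x y
min∞-≤ˡ (fin x) ∞       = ≤-refl
min∞-≤ˡ ∞       y       = ≤∞-top y

min∞-≤ʳ : ∀ x y → min∞ x y ≤∞ y
min∞-≤ʳ (fin x) (fin y) = p⊓q≤q x y
min∞-≤ʳ (fin x) ∞       = tt
min∞-≤ʳ ∞       (fin y) = ≤-refl
min∞-≤ʳ ∞       ∞       = tt

min∞-greatest : ∀ a x y → a ≤∞ x → a ≤∞ y → a ≤∞ min∞ x y
min∞-greatest (fin a) (fin x) (fin y) a≤x a≤y = ⊓-glb a≤x a≤y
min∞-greatest (fin a) (fin x) ∞       a≤x _   = a≤x
min∞-greatest a       ∞       y       _   a≤y = a≤y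

minimum∞-≤ : ∀ {A : Set} (f : A → ℚ∞) {xs x} → x ∈ₗ xs → minimum∞ (map f xs) ≤∞ f x
minimum∞-≤ f {y ∷ xs} (here refl)        = min∞-≤ˡ (f y) _
minimum∞-≤ f {y ∷ xs} {x} (there x∈xs) =
  ≤∞-trans _ _ (f x) (min∞-≤ʳ (f y) _) (minimum∞-≤ f x∈xs)

minimum∞-greatest : ∀ {A : Set} (f : A → ℚ∞) a xs →
                    (∀ {x} → x ∈ₗ xs → a ≤∞ f x) → a ≤∞ minimum∞ (map f xs)
minimum∞-greatest f a []       _ = ≤∞-top a
minimum∞-greatest f a (x ∷ xs) h =
  min∞-greatest a (f x) _ (h (here refl)) (minimum∞-greatest f a xs (h ∘ there))

filterᵇ-length-mono : ∀ {A : Set} (P Q : A → Bool) xs → (∀ x → T (P x) → T (Q x)) →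
                      length (filterᵇ P xs) ℕ.≤ length (filterᵇ Q xs)
filterᵇ-length-mono P Q xs P⇒Q =
  length-mono-≤ (⊆-filter-Sublist (T? ∘ P) (T? ∘ Q) (λ { refl → P⇒Q _ }) (⊆-refl {x = xs}))

sum-≥-count : ∀ {A : Set} (f : A → ℚ) (P Q : A → Bool) u xs →
              (∀ x → 0ℚ ≤ f x) → (∀ x → T (P x ∧ Q x) → u ≤ f x) →
              fromℕ (length (filterᵇ (λ x → P x ∧ Q x) xs)) * u ≤ sumℚ (map f (filterᵇ Q xs))
sum-≥-count f P Q u [] _ _ = ≤-reflexive (*-zeroˡ u)
sum-≥-count f P Q u (x ∷ xs) f≥0 u≤f with P x | Q x | u≤f x
... | true  | true  | u≤fx = begin
  fromℕ (suc N) * u     ≡⟨ cong (_* u) (fromℕ-suc N) ⟩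
  (1ℚ + fromℕ N) * u    ≡⟨ *-distribʳ-+ u 1ℚ (fromℕ N) ⟩
  1ℚ * u + fromℕ N * u  ≡⟨ cong (_+ fromℕ N * u) (*-identityˡ u) ⟩
  u + fromℕ N * u       ≤⟨ +-mono-≤ (u≤fx tt) (sum-≥-count f P Q u xs f≥0 u≤f) ⟩
  f x + sumℚ (map f (filterᵇ Q xs))  ∎
  where
  open ≤-Reasoning
  N = length (filterᵇ (λ x → P x ∧ Q x) xs)
... | false | true  | _ =
  ≤-trans (≤-reflexive (sym (+-identityˡ _))) (+-mono-≤ (f≥0 x) (sum-≥-count f P Q u xs f≥0 u≤f))
... | true  | false | _ = sum-≥-count f P Q u xs f≥0 u≤f
... | false | false | _ = sum-≥-count f P Q u xs f≥0 u≤f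

sumℚ-zeros : ∀ {A : Set} (xs : List A) → sumℚ (map (λ _ → 0ℚ) xs) ≡ 0ℚ
sumℚ-zeros []       = refl
sumℚ-zeros (x ∷ xs) = trans (cong (_+_ 0ℚ) (sumℚ-zeros xs)) (+-identityˡ 0ℚ)

T-not : ∀ {b} → T b → T (not b) → ⊥
T-not {true} _ ()

module ForwardPhase {n m : ℕ} (𝒮 : Fin m → Subset n) (w : Fin m → ℚ) (w>0 : ∀ i → 0ℚ < w i) where
  open System 𝒮
  open Forward w

  -- A set participating in iteration j+1 participated in iteration j and was not added
  -- to 𝒜 after it: its payment is below one eighth of its weight.  (If i was already in
  -- 𝒜, the update rule keeps it there, so that case is absurd.)
  still-participating : ∀ R st i → T (partSet (step R st) i) →
                        T (partSet st i) × αsum (α (step R st)) i < w i * ((+ 1) / 8)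
  still-participating R st i not-added
    with mem i (𝒜 st) | subst (T ∘ not) (lookup∘tabulate _ i) not-added
  ... | false | below-threshold = tt , ≰⇒> λ reached → T-not (≤⇒≤ᵇ reached) below-threshold

  stays-added : ∀ R st i → T (mem i (𝒜 st)) → T (mem i (𝒜 (step R st)))
  stays-added R st i i∈𝒜 with mem i (𝒜 (step R st)) in i∉𝒜′
  ... | true  = tt
  ... | false = ⊥-elim (T-not i∈𝒜 (proj₁ (still-participating R st i (subst (T ∘ not) (sym i∉𝒜′) tt))))

  stays-covered : ∀ R st e → T (covered st e) → T (covered (step R st) e)
  stays-covered R st e =
    any⁺ _ ∘ Any.map (λ {i} h → let i∈𝒜 , e∈S = Equivalence.to T-∧ h in
                        Equivalence.from T-∧ (stays-added R st i i∈𝒜 , e∈S))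
           ∘ any⁻ _ (allFin m)

  participated-before : ∀ R st e → T (partElem R (step R st) e) → T (partElem R st e)
  participated-before R st e h with mem e R | covered st e | stays-covered R st e
  ... | true | false | _      = tt
  ... | true | true  | covers = ⊥-elim (T-not (covers tt) h)

  α-step : ∀ R st e → T (partElem R st e) → α (step R st) e ≡ α st e + incr (q R st e)
  α-step R st e participating with partElem R st e
  ... | true = refl

  participating-set : ∀ st {i} → i ∈ₗ partSets st → T (partSet st i)
  participating-set st i∈ = proj₂ (∈-filter⁻ (T? ∘ partSet st) {xs = allFin m} i∈)

  record Sound (st : State) : Set where
    field
      α-nonneg  : ∀ e → 0ℚ ≤ α st e
      underpaid : ∀ i → T (partSet st i) → αsum (α st) i < w i * ((+ 1) / 8)
  open Sound

  price-nonneg : ∀ R st i → Sound st → T (partSet st i) → fin 0ℚ ≤∞ p R st i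
  price-nonneg R st i sound i-part with d R st i
  ... | zero  = tt
  ... | suc k = begin
    0ℚ                    ≡⟨ sym (*-zeroˡ r) ⟩
    0ℚ * r                ≤⟨ *-monoʳ-≤-nonNeg r {{normalize-nonNeg 1 (suc k)}} residual≥0 ⟩
    c st i * r            ∎
    where
    open ≤-Reasoning
    r = (+ 1) / suc k
    residual≥0 = residual-nonneg (w i) _ (<⇒≤ (w>0 i)) (<⇒≤ (underpaid sound i i-part))

  incr-nonneg : ∀ R st e → Sound st → 0ℚ ≤ incr (q R st e)
  incr-nonneg R st e sound = from-bound (q R st e)
    (minimum∞-greatest (p R st) (fin 0ℚ) _ λ i∈ →
      price-nonneg R st _ sound (participating-set st (proj₁ (∈-filter⁻ _ i∈))))
    where
    from-bound : ∀ x → fin 0ℚ ≤∞ x → 0ℚ ≤ incr x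
    from-bound (fin x) 0≤x = 0≤x
    from-bound ∞       _   = ≤-refl

  sound-init : Sound initState
  α-nonneg  sound-init e   = ≤-refl
  underpaid sound-init i _ = begin-strict
    αsum (α initState) i     ≡⟨ sumℚ-zeros (filterᵇ (λ e → mem e (𝒮 i)) (allFin n)) ⟩
    0ℚ                       ≡⟨ sym (*-zeroˡ ((+ 1) / 8)) ⟩
    0ℚ * ((+ 1) / 8)         <⟨ *-monoˡ-<-pos ((+ 1) / 8) (w>0 i) ⟩
    w i * ((+ 1) / 8)        ∎
    where open ≤-Reasoning

  sound-step : ∀ R st → Sound st → Sound (step R st)
  α-nonneg  (sound-step R st sound) e with partElem R st e
  ... | true  = ≤-trans (≤-reflexive (sym (+-identityˡ 0ℚ)))
                        (+-mono-≤ (α-nonneg sound e) (incr-nonneg R st e sound))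
  ... | false = α-nonneg sound e
  underpaid (sound-step R st sound) i i-part = proj₂ (still-participating R st i i-part)

  sound-iter : ∀ R j st → Sound st → Sound (iter (step R) j st)
  sound-iter R zero    st sound = sound
  sound-iter R (suc j) st sound = sound-step R _ (sound-iter R j st sound)

  sound-epoch : ∀ {R st st′} → EpochRun R st st′ → Sound st → Sound st′
  sound-epoch (done _)                 sound = sound
  sound-epoch {R} (more {st = st} _ run) sound = sound-epoch run (sound-step R st sound)

  sound-epochs : ∀ {Zs st st′} → EpochsRun Zs st st′ → Sound st → Sound st′
  sound-epochs []           sound = sound
  sound-epochs (run ∷ runs) sound = sound-epochs runs (sound-epoch run sound)

  pmin-≤ : ∀ R st {S} → T (partSet st S) → pmin R st ≤∞ p R st S
  pmin-≤ R st {S} S-part = minimum∞-≤ (p R st) (∈-filter⁺ (T? ∘ partSet st) (∈-allFin S) S-part)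

  -- A set with k+1 participating elements in iteration j+1 had at least as many in
  -- iteration j, so its price p_j(S) is finite.
  finite-price-before : ∀ R st S k → d R (step R st) S ≡ suc k → ∃ λ v → p R st S ≡ fin v
  finite-price-before R st S k d′≡ = finite (subst (ℕ._≤ d R st S) d′≡ fewer)
    where
    fewer : d R (step R st) S ℕ.≤ d R st S
    fewer = filterᵇ-length-mono _ _ (allFin n) λ e h →
      let e-part′ , e∈S = Equivalence.to T-∧ h in
      Equivalence.from T-∧ (participated-before R st e e-part′ , e∈S)
    finite : suc k ℕ.≤ d R st S → ∃ λ v → p R st S ≡ fin v
    finite _ with d R st S
    ... | suc _ = _ , refl

  incr-≥ : ∀ {u v} x → fin u ≤∞ x → x ≤∞ fin v → u ≤ incr x
  incr-≥ (fin x) u≤x _ = u≤x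

  gain : ∀ R st {S u v e} → Sound st → pmin R st ≡ fin u → T (partSet st S) → p R st S ≡ fin v →
         T (partElem R (step R st) e ∧ mem e (𝒮 S)) → u ≤ α (step R st) e
  gain R st {S} {u} {v} {e} sound μ≡u S-part pS≡v h = begin
    u                         ≡⟨ sym (+-identityˡ u) ⟩
    0ℚ + u                    ≤⟨ +-mono-≤ (α-nonneg sound e) (incr-≥ (q R st e) u≤q q≤v) ⟩
    α st e + incr (q R st e)  ≡⟨ sym (α-step R st e e-part) ⟩
    α (step R st) e           ∎
    where
    open ≤-Reasoning
    e-part′ = proj₁ (Equivalence.to T-∧ h)
    e∈S     = proj₂ (Equivalence.to T-∧ h)
    e-part  = participated-before R st e e-part′
    u≤q : fin u ≤∞ q R st e
    u≤q = minimum∞-greatest (p R st) (fin u) _ λ i∈ →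
      subst (_≤∞ p R st _) μ≡u (pmin-≤ R st (participating-set st (proj₁ (∈-filter⁻ _ i∈))))
    q≤v : q R st e ≤∞ fin v
    q≤v = subst (q R st e ≤∞_) pS≡v
      (minimum∞-≤ (p R st) (∈-filter⁺ _ (∈-filter⁺ (T? ∘ partSet st) (∈-allFin S) S-part) e∈S))

  set-price-growth : ∀ R st {S k u v} → Sound st → pmin R st ≡ fin u →
                     T (partSet (step R st) S) → d R (step R st) S ≡ suc k → p R st S ≡ fin v →
                     ((+ 3) / 2) * u ≤ c (step R st) S * ((+ 1) / suc k)
  set-price-growth R st {S} {k} {u} sound μ≡u S-part′ d′≡ pS≡v =
    price-growth k u A (w S) (<⇒≤ (w>0 S)) paid (<⇒≤ (proj₂ (still-participating R st S S-part′)))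
    where
    A = αsum (α (step R st)) S
    paid : fromℕ (suc k) * u ≤ A
    paid = subst (λ d → fromℕ d * u ≤ A) d′≡
      (sum-≥-count (α (step R st)) (partElem R (step R st)) (λ e → mem e (𝒮 S)) u (allFin n)
        (α-nonneg (sound-step R st sound))
        (λ e → gain R st sound μ≡u (proj₁ (still-participating R st S S-part′)) pS≡v))

  price-growth-step : ∀ R st → Sound st → scale∞ ((+ 3) / 2) (pmin R st) ≤∞ pmin R (step R st)
  price-growth-step R st sound =
    minimum∞-greatest (p R st′) _ (partSets st′) λ S∈ → at-set (participating-set st′ S∈)
    where
    st′ = step R st
    at-set : ∀ {S} → T (partSet st′ S) → scale∞ ((+ 3) / 2) (pmin R st) ≤∞ p R st′ S
    at-set {S} S-part′ with d R st′ S in d′≡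
    ... | zero  = ≤∞-top _
    ... | suc k with finite-price-before R st S k d′≡
    ...   | v , pS≡v with ≤∞-fin (pmin R st) v
                            (subst (pmin R st ≤∞_) pS≡v (pmin-≤ R st (proj₁ (still-participating R st S S-part′))))
    ...     | u , μ≡u = subst (λ μ → scale∞ ((+ 3) / 2) μ ≤∞ fin (c st′ S * ((+ 1) / suc k))) (sym μ≡u)
                          (set-price-growth R st sound μ≡u S-part′ d′≡ pS≡v)

-- Every state reached in epoch k is sound, so the growth step applies to iteration j.
lemma2 : ∀ {n m : ℕ} (𝒮 : Fin m → Subset n) (w : Fin m → ℚ) (τ : ℕ) →
    System.SNCSystem 𝒮 τ →
    (∀ i → 0ℚ < w i) →
    System.Covers 𝒮 →
    (Zs : List (Subset n)) → System.LayerDecomposition 𝒮 τ Zs →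
    (pre : List (Subset n)) (Z : Subset n) (post : List (Subset n)) →
    Zs ≡ pre ++ (Z ∷ post) →
    (st₀ : System.State 𝒮) →
    System.Forward.EpochsRun 𝒮 w pre (System.initState 𝒮) st₀ →
    (j : ℕ) →
    (∀ i → i ℕ.≤ suc j →
       System.Forward.Uncovered 𝒮 w (System.Forward.remaining 𝒮 w Z st₀)
         (iter (System.Forward.step 𝒮 w (System.Forward.remaining 𝒮 w Z st₀)) i st₀)) →
    scale∞ ((+ 3) / 2)
      (System.Forward.pmin 𝒮 w (System.Forward.remaining 𝒮 w Z st₀)
        (iter (System.Forward.step 𝒮 w (System.Forward.remaining 𝒮 w Z st₀)) j st₀))
    ≤∞
      System.Forward.pmin 𝒮 w (System.Forward.remaining 𝒮 w Z st₀)
        (iter (System.Forward.step 𝒮 w (System.Forward.remaining 𝒮 w Z st₀)) (suc j) st₀)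
lemma2 𝒮 w _ _ w>0 _ _ _ _ Z _ _ st₀ earlier-epochs j _ =
  price-growth-step R (iter (step R) j st₀) (sound-iter R j st₀ start-sound)
  where
  open ForwardPhase 𝒮 w w>0
  open System.Forward 𝒮 w using (step; remaining)
  R = remaining Z st₀
  start-sound : Sound st₀
  start-sound = sound-epochs earlier-epochs sound-init
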